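{- Let $q$ be a prime power, let $\gamma,\omega\in\mathbb{F}_{q^2}$ be linearly independent over $\mathbb{F}_q$, and let $f\colon\mathbb{F}_{q^2}\to\mathbb{F}_q$ be a function satisfying $f(u\cdot x)=u\cdot f(x)$ for all $u\in\mathbb{F}_q$ and $x\in\mathbb{F}_{q^2}$. Then $x\mapsto x+\gamma\cdot f(x)$ permutes $\mathbb{F}_{q^2}$ if and only if $f(\gamma)\ne -1$ and $x\mapsto x+f(\omega+\gamma x)$ permutes $\mathbb{F}_q$.
   Context: $\mathbb{F}_q$ denotes the finite field with $q$ elements, a subfield of $\mathbb{F}_{q^2}$. -}

module Defs where

open import Level using (0ℓ)
open import Data.Nat using (ℕ; _^_; _≥_)
open import Data.Nat.Primality using (Prime)
open import Data.Fin using (Fin)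
open import Data.Product using (Σ; _×_; ∃)
open import Relation.Binary.PropositionalEquality using (_≡_)
open import Relation.Nullary using (¬_)
open import Function.Bundles using (_↔_)
open import Algebra.Structures using (IsCommutativeRing)

IsPrimePower : ℕ → Set
IsPrimePower q = Σ ℕ λ p → Σ ℕ λ k → Prime p × k ≥ 1 × q ≡ p ^ k

record Field : Set₁ where
  infixl 7 _*_
  infixl 6 _+_
  field
    Carrier : Set
    _+_ _*_ : Carrier → Carrier → Carrier
    -_ : Carrier → Carrier
    0# 1# : Carrier
    isCommutativeRing : IsCommutativeRing _≡_ _+_ _*_ -_ 0# 1#
    0≢1 : ¬ (0# ≡ 1#)
    inverse : (x : Carrier) → ¬ (x ≡ 0#) → Σ Carrier λ y → x * y ≡ 1#

record FiniteField (n : ℕ) : Set₁ where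
  field
    field' : Field
  open Field field' public
  field
    enumeration : Carrier ↔ Fin n

record FieldEmbedding (F K : Field) : Set where
  private
    module F = Field F
    module K = Field K
  field
    ι : F.Carrier → K.Carrier
    ι-+ : ∀ a b → ι (a F.+ b) ≡ ι a K.+ ι b
    ι-* : ∀ a b → ι (a F.* b) ≡ ι a K.* ι b
    ι-1 : ι F.1# ≡ K.1#
    ι-injective : ∀ a b → ι a ≡ ι b → a ≡ b

-- Write the elements of 𝔽_{q²} in coordinates aγ + bω over the basis γ, ω. Since f takes values
-- in 𝔽_q, the map g x = x + γ f(x) only moves the γ-coordinate, so g permutes 𝔽_{q²} iff for
-- every b ∈ 𝔽_q the fibre map a ↦ a + f(aγ + bω) permutes 𝔽_q. By 𝔽_q-linearity of f, for
-- b = 0 this is multiplication by 1 + f(γ), and for b ≠ 0 it is h x = x + f(ω + γx) conjugated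
-- by the scaling x ↦ bx. Finiteness turns injectivity into bijectivity throughout.
{-# OPTIONS --safe #-}
module Submission where

open import Defs
open import Algebra.Bundles using (CommutativeRing)
import Algebra.Properties.Group as GroupProperties
import Algebra.Properties.Ring as RingProperties
open import Data.Empty using (⊥-elim)
open import Data.Fin using (Fin; punchOut)
open import Data.Fin.Properties using (any?; punchOut-injective; <⇒notInjective; inj⇒≟; *↔×)
  renaming (_≟_ to _≟ᶠ_)
open import Data.Maybe using (nothing)
open import Data.Nat as ℕ using (ℕ; zero; suc; _^_)
open import Data.Nat.Properties using (n<1+n; *-identityʳ)
open import Data.Product using (_×_; _,_; proj₁; proj₂)
open import Data.Product.Function.NonDependent.Propositional using (_×-↔_; _×-⇔_)
open import Function.Bundles using (_↔_; _⇔_; mk⇔; Equivalence; Inverse; Injection)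
open import Function.Consequences.Propositional using (strictlySurjective⇒surjective)
open import Function.Construct.Composition using (_⇔-∘_)
open import Function.Construct.Identity using (⇔-id)
open import Function.Construct.Symmetry using (⇔-sym)
open import Function.Definitions using (Injective; StrictlySurjective; Bijective)
open import Function.Properties.Inverse using (↔-sym; ↔-trans; Inverse⇒Injection)
open import Function.Related.TypeIsomorphisms using (¬-cong-⇔)
open import Relation.Binary.PropositionalEquality
open import Relation.Nullary using (¬_; yes; no)
open import Tactic.RingSolver.Core.AlmostCommutativeRing
  using (AlmostCommutativeRing; fromCommutativeRing)
import Tactic.RingSolver.NonReflective as RingSolver

Fin-injective⇒strictlySurjective : ∀ {n} {f : Fin n → Fin n} →
  Injective _≡_ _≡_ f → StrictlySurjective _≡_ f
Fin-injective⇒strictlySurjective {zero}  _     ()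
Fin-injective⇒strictlySurjective {suc n} {f} f-inj y with any? (λ x → f x ≟ᶠ y)
... | yes hit  = hit
... | no  miss = ⊥-elim (<⇒notInjective (n<1+n n) squeezed-injective)
  where
  -- If y is missed, punching it out of the image squeezes Fin (suc n) injectively into Fin n.
  avoids : ∀ x → y ≢ f x
  avoids x y≡fx = miss (x , sym y≡fx)

  squeezed-injective : Injective _≡_ _≡_ (λ x → punchOut (avoids x))
  squeezed-injective {x} {x′} eq = f-inj (punchOut-injective (avoids x) (avoids x′) eq)

module _ {A B : Set} {n : ℕ} (A↔ : A ↔ Fin n) (B↔ : B ↔ Fin n) where
  private
    module A = Inverse A↔

    to-injective : Injective _≡_ _≡_ (Inverse.to B↔)
    to-injective = Injection.injective (Inverse⇒Injection B↔)

    from-injective : Injective _≡_ _≡_ A.from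
    from-injective = Injection.injective (Inverse⇒Injection (↔-sym A↔))

  injective⇒strictlySurjective : {f : A → B} →
    Injective _≡_ _≡_ f → StrictlySurjective _≡_ f
  injective⇒strictlySurjective {f} f-inj y =
    let i , hits = Fin-injective⇒strictlySurjective {f = λ i → Inverse.to B↔ (f (A.from i))}
                     (λ eq → from-injective (f-inj (to-injective eq))) (Inverse.to B↔ y)
    in A.from i , to-injective hits

  injective⇒bijective : {f : A → B} → Injective _≡_ _≡_ f → Bijective _≡_ _≡_ f
  injective⇒bijective f-inj =
    f-inj , strictlySurjective⇒surjective (injective⇒strictlySurjective f-inj)

  bijective⇔injective : {f : A → B} → Bijective _≡_ _≡_ f ⇔ Injective _≡_ _≡_ f
  bijective⇔injective = mk⇔ proj₁ injective⇒bijective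

×↔Fin^2 : ∀ {A : Set} {n} → A ↔ Fin n → (A × A) ↔ Fin (n ^ 2)
×↔Fin^2 {A} {n} A↔ = subst (λ m → (A × A) ↔ Fin m) (cong (n ℕ.*_) (sym (*-identityʳ n)))
  (↔-trans (A↔ ×-↔ A↔) (↔-sym *↔×))

module _ {A B : Set} {φ : A → B}
  (φ-injective : Injective _≡_ _≡_ φ) (φ-surjective : StrictlySurjective _≡_ φ) where

  conjugate-injective⇔ : {F : A → A} {g : B → B} → (∀ a → g (φ a) ≡ φ (F a)) →
    Injective _≡_ _≡_ g ⇔ Injective _≡_ _≡_ F
  conjugate-injective⇔ {F} {g} g∘φ≗φ∘F = mk⇔ to from
    where
    to : Injective _≡_ _≡_ g → Injective _≡_ _≡_ F
    to g-inj {a} {a′} eq =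
      φ-injective (g-inj (trans (g∘φ≗φ∘F a) (trans (cong φ eq) (sym (g∘φ≗φ∘F a′)))))

    from : Injective _≡_ _≡_ F → Injective _≡_ _≡_ g
    from F-inj {x} {y} eq with a , refl ← φ-surjective x | a′ , refl ← φ-surjective y =
      cong φ (F-inj (φ-injective (trans (sym (g∘φ≗φ∘F a)) (trans eq (g∘φ≗φ∘F a′)))))

≗⇒injective⇔ : {A B : Set} {f g : A → B} → f ≗ g → Injective _≡_ _≡_ f ⇔ Injective _≡_ _≡_ g
≗⇒injective⇔ f≗g = mk⇔ (along f≗g) (along (λ x → sym (f≗g x)))
  where
  along : ∀ {A B : Set} {u v : A → B} → u ≗ v → Injective _≡_ _≡_ u → Injective _≡_ _≡_ v
  along u≗v u-inj {x} {y} eq = u-inj (trans (u≗v x) (trans eq (sym (u≗v y))))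

fibrewise : {A B : Set} → (B → A → A) → A × B → A × B
fibrewise G (a , b) = G b a , b

fibrewise-injective⇔ : {A B : Set} (G : B → A → A) →
  Injective _≡_ _≡_ (fibrewise G) ⇔ (∀ b → Injective _≡_ _≡_ (G b))
fibrewise-injective⇔ G = mk⇔ to from
  where
  to : Injective _≡_ _≡_ (fibrewise G) → ∀ b → Injective _≡_ _≡_ (G b)
  to inj b eq = cong proj₁ (inj (cong (_, b) eq))

  from : (∀ b → Injective _≡_ _≡_ (G b)) → Injective _≡_ _≡_ (fibrewise G)
  from inj {a , b} {a′ , b′} eq with refl ← cong proj₂ eq = cong (_, b) (inj b (cong proj₁ eq))

module FieldProperties (F : Field) where
  open Field F public

  commutativeRing : CommutativeRing _ _
  commutativeRing = record { isCommutativeRing = isCommutativeRing }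

  open CommutativeRing commutativeRing public
    using ( +-identityˡ; +-identityʳ; +-comm; -‿inverseʳ; *-identityˡ
          ; *-assoc; *-comm; zeroˡ; zeroʳ; distribˡ; distribʳ; +-group; ring)
  open GroupProperties +-group public
    using (inverseʳ-unique; identityˡ-unique; x∙y⁻¹≈ε⇒x≈y; //-rightDividesˡ)
  open RingProperties ring public using (x+x≈x⇒x≈0)

  almostCommutativeRing : AlmostCommutativeRing _ _
  almostCommutativeRing = fromCommutativeRing commutativeRing (λ _ → nothing)

  *-cancelˡ : ∀ {c} → c ≢ 0# → Injective _≡_ _≡_ (c *_)
  *-cancelˡ {c} c≢0 {x} {y} eq with c⁻¹ , cc⁻¹≡1 ← inverse c c≢0 = begin
    x              ≡⟨ sym (*-identityˡ x) ⟩
    1# * x         ≡⟨ cong (_* x) (trans (sym cc⁻¹≡1) (*-comm c c⁻¹)) ⟩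
    c⁻¹ * c * x    ≡⟨ *-assoc c⁻¹ c x ⟩
    c⁻¹ * (c * x)  ≡⟨ cong (c⁻¹ *_) eq ⟩
    c⁻¹ * (c * y)  ≡⟨ *-assoc c⁻¹ c y ⟨
    c⁻¹ * c * y    ≡⟨ cong (_* y) (trans (*-comm c⁻¹ c) cc⁻¹≡1) ⟩
    1# * y         ≡⟨ *-identityˡ y ⟩
    y              ∎
    where open ≡-Reasoning

  *-injective⇔≢0 : ∀ {c} → Injective _≡_ _≡_ (c *_) ⇔ c ≢ 0#
  *-injective⇔≢0 {c} = mk⇔ injective⇒≢0 *-cancelˡ
    where
    injective⇒≢0 : Injective _≡_ _≡_ (c *_) → c ≢ 0#
    injective⇒≢0 inj refl = 0≢1 (inj (trans (zeroʳ 0#) (sym (zeroˡ 1#))))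

  *-strictlySurjective : ∀ {c} → c ≢ 0# → StrictlySurjective _≡_ (c *_)
  *-strictlySurjective {c} c≢0 y with c⁻¹ , cc⁻¹≡1 ← inverse c c≢0 = c⁻¹ * y , (begin
    c * (c⁻¹ * y)  ≡⟨ *-assoc c c⁻¹ y ⟨
    c * c⁻¹ * y    ≡⟨ cong (_* y) cc⁻¹≡1 ⟩
    1# * y         ≡⟨ *-identityˡ y ⟩
    y              ∎)
    where open ≡-Reasoning

  1≢0 : 1# ≢ 0#
  1≢0 1≡0 = 0≢1 (sym 1≡0)

  1+x≡0⇔x≡-1 : ∀ {x} → 1# + x ≡ 0# ⇔ x ≡ - 1#
  1+x≡0⇔x≡-1 {x} = mk⇔ (inverseʳ-unique 1# x) λ { refl → -‿inverseʳ 1# }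

module EmbeddingProperties {F K : Field} (E : FieldEmbedding F K) where
  private
    module F = FieldProperties F
    module K = FieldProperties K
  open FieldEmbedding E

  ι-0 : ι F.0# ≡ K.0#
  ι-0 = K.x+x≈x⇒x≈0 (ι F.0#) (trans (sym (ι-+ F.0# F.0#)) (cong ι (F.+-identityˡ F.0#)))

module PermutationCriterion {q : ℕ} (Fq : FiniteField q) (Fq² : FiniteField (q ^ 2))
  (E : FieldEmbedding (FiniteField.field' Fq) (FiniteField.field' Fq²)) where
  private
    module k = FieldProperties (FiniteField.field' Fq)
    module K = FieldProperties (FiniteField.field' Fq²)
  open FieldEmbedding E
  open EmbeddingProperties E
  open RingSolver K.almostCommutativeRing
  open ≡-Reasoning

  module _ (γ ω : K.Carrier)
    (independent : ∀ a b → ι a K.* γ K.+ ι b K.* ω ≡ K.0# → (a ≡ k.0#) × (b ≡ k.0#))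
    (f : K.Carrier → k.Carrier) (f-linear : ∀ u x → f (ι u K.* x) ≡ u k.* f x) where

    φ : k.Carrier × k.Carrier → K.Carrier
    φ (a , b) = ι a K.* γ K.+ ι b K.* ω

    g : K.Carrier → K.Carrier
    g x = x K.+ γ K.* ι (f x)

    h : k.Carrier → k.Carrier
    h x = x k.+ f (ω K.+ γ K.* ι x)

    fibre : k.Carrier → k.Carrier → k.Carrier
    fibre b a = a k.+ f (φ (a , b))

    φ-+ : ∀ a b a′ b′ → φ (a k.+ a′ , b k.+ b′) ≡ φ (a , b) K.+ φ (a′ , b′)
    φ-+ a b a′ b′ = begin
      ι (a k.+ a′) K.* γ K.+ ι (b k.+ b′) K.* ω
        ≡⟨ cong₂ (λ u v → u K.* γ K.+ v K.* ω) (ι-+ a a′) (ι-+ b b′) ⟩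
      (ι a K.+ ι a′) K.* γ K.+ (ι b K.+ ι b′) K.* ω
        ≡⟨ solve 6 (λ A A′ B B′ G W →
             ((A ⊕ A′) ⊗ G ⊕ (B ⊕ B′) ⊗ W) ⊜ ((A ⊗ G ⊕ B ⊗ W) ⊕ (A′ ⊗ G ⊕ B′ ⊗ W)))
             refl (ι a) (ι a′) (ι b) (ι b′) γ ω ⟩
      φ (a , b) K.+ φ (a′ , b′) ∎

    φ-injective : Injective _≡_ _≡_ φ
    φ-injective {a , b} {a′ , b′} eq =
      let a-a′≡0 , b-b′≡0 = independent _ _ φ-difference≡0
      in cong₂ _,_ (k.x∙y⁻¹≈ε⇒x≈y a a′ a-a′≡0) (k.x∙y⁻¹≈ε⇒x≈y b b′ b-b′≡0)
      where
      φ-difference≡0 : φ (a k.+ k.- a′ , b k.+ k.- b′) ≡ K.0#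
      φ-difference≡0 = K.identityˡ-unique _ (φ (a′ , b′)) (begin
        φ (a k.+ k.- a′ , b k.+ k.- b′) K.+ φ (a′ , b′)
          ≡⟨ φ-+ _ _ a′ b′ ⟨
        φ (a k.+ k.- a′ k.+ a′ , b k.+ k.- b′ k.+ b′)
          ≡⟨ cong₂ (λ u v → φ (u , v)) (k.//-rightDividesˡ a′ a) (k.//-rightDividesˡ b′ b) ⟩
        φ (a , b)
          ≡⟨ eq ⟩
        φ (a′ , b′) ∎)

    φ-strictlySurjective : StrictlySurjective _≡_ φ
    φ-strictlySurjective = injective⇒strictlySurjective
      (×↔Fin^2 (FiniteField.enumeration Fq)) (FiniteField.enumeration Fq²) φ-injective

    g∘φ : ∀ p → g (φ p) ≡ φ (fibrewise fibre p)
    g∘φ (a , b) = begin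
      (ι a K.* γ K.+ ι b K.* ω) K.+ γ K.* ι (f (φ (a , b)))
        ≡⟨ solve 5 (λ A B G W C → ((A ⊗ G ⊕ B ⊗ W) ⊕ G ⊗ C) ⊜ ((A ⊕ C) ⊗ G ⊕ B ⊗ W))
             refl (ι a) (ι b) γ ω (ι (f (φ (a , b)))) ⟩
      (ι a K.+ ι (f (φ (a , b)))) K.* γ K.+ ι b K.* ω
        ≡⟨ cong (λ u → u K.* γ K.+ ι b K.* ω) (ι-+ a (f (φ (a , b)))) ⟨
      φ (fibre b a , b) ∎

    fibre-0 : ∀ a → fibre k.0# a ≡ (k.1# k.+ f γ) k.* a
    fibre-0 a = begin
      a k.+ f (ι a K.* γ K.+ ι k.0# K.* ω)
        ≡⟨ cong (λ u → a k.+ f (ι a K.* γ K.+ u)) (trans (cong (K._* ω) ι-0) (K.zeroˡ ω)) ⟩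
      a k.+ f (ι a K.* γ K.+ K.0#)     ≡⟨ cong (λ u → a k.+ f u) (K.+-identityʳ _) ⟩
      a k.+ f (ι a K.* γ)               ≡⟨ cong (a k.+_) (f-linear a γ) ⟩
      a k.+ a k.* f γ                   ≡⟨ cong₂ k._+_ (k.*-identityˡ a) (k.*-comm (f γ) a) ⟨
      k.1# k.* a k.+ f γ k.* a          ≡⟨ k.distribʳ a k.1# (f γ) ⟨
      (k.1# k.+ f γ) k.* a              ∎

    fibre-scale : ∀ b c → fibre b (b k.* c) ≡ b k.* h c
    fibre-scale b c = begin
      b k.* c k.+ f (φ (b k.* c , b))
        ≡⟨ cong (λ u → b k.* c k.+ f u) φ-scale ⟩
      b k.* c k.+ f (ι b K.* (ω K.+ γ K.* ι c))
        ≡⟨ cong (b k.* c k.+_) (f-linear b _) ⟩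
      b k.* c k.+ b k.* f (ω K.+ γ K.* ι c)
        ≡⟨ k.distribˡ b c _ ⟨
      b k.* h c ∎
      where
      φ-scale : φ (b k.* c , b) ≡ ι b K.* (ω K.+ γ K.* ι c)
      φ-scale = begin
        ι (b k.* c) K.* γ K.+ ι b K.* ω
          ≡⟨ cong (λ u → u K.* γ K.+ ι b K.* ω) (ι-* b c) ⟩
        ι b K.* ι c K.* γ K.+ ι b K.* ω
          ≡⟨ cong (K._+ ι b K.* ω) (trans (K.*-assoc (ι b) (ι c) γ) (cong (ι b K.*_) (K.*-comm (ι c) γ))) ⟩
        ι b K.* (γ K.* ι c) K.+ ι b K.* ω
          ≡⟨ K.distribˡ (ι b) (γ K.* ι c) ω ⟨
        ι b K.* (γ K.* ι c K.+ ω)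
          ≡⟨ cong (ι b K.*_) (K.+-comm (γ K.* ι c) ω) ⟩
        ι b K.* (ω K.+ γ K.* ι c) ∎

    g-injective⇔ : Injective _≡_ _≡_ g ⇔ (∀ b → Injective _≡_ _≡_ (fibre b))
    g-injective⇔ =
      fibrewise-injective⇔ fibre ⇔-∘ conjugate-injective⇔ φ-injective φ-strictlySurjective g∘φ

    fibre-0-injective⇔ : Injective _≡_ _≡_ (fibre k.0#) ⇔ (¬ f γ ≡ k.- k.1#)
    fibre-0-injective⇔ =
      ¬-cong-⇔ k.1+x≡0⇔x≡-1 ⇔-∘ (k.*-injective⇔≢0 ⇔-∘ ≗⇒injective⇔ fibre-0)

    fibre-injective⇔h : ∀ {b} → b ≢ k.0# → Injective _≡_ _≡_ (fibre b) ⇔ Injective _≡_ _≡_ h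
    fibre-injective⇔h b≢0 =
      conjugate-injective⇔ (k.*-cancelˡ b≢0) (k.*-strictlySurjective b≢0) (fibre-scale _)

    fibres-injective⇔ : (∀ b → Injective _≡_ _≡_ (fibre b)) ⇔
                        ((¬ f γ ≡ k.- k.1#) × Injective _≡_ _≡_ h)
    fibres-injective⇔ = mk⇔ to from
      where
      to : (∀ b → Injective _≡_ _≡_ (fibre b)) → (¬ f γ ≡ k.- k.1#) × Injective _≡_ _≡_ h
      to inj = Equivalence.to fibre-0-injective⇔ (inj k.0#) , h-injective
        where
        h-injective : Injective _≡_ _≡_ h
        h-injective = Equivalence.to (fibre-injective⇔h k.1≢0) (inj k.1#)

      from : (¬ f γ ≡ k.- k.1#) × Injective _≡_ _≡_ h → ∀ b → Injective _≡_ _≡_ (fibre b)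
      from (fγ≢-1 , h-inj) b
        with inj⇒≟ (Inverse⇒Injection (FiniteField.enumeration Fq)) b k.0#
      ... | yes refl = Equivalence.from fibre-0-injective⇔ fγ≢-1
      ... | no  b≢0  = Equivalence.from (fibre-injective⇔h b≢0) h-inj

    g-bijective⇔ : Bijective _≡_ _≡_ g ⇔ ((¬ f γ ≡ k.- k.1#) × Bijective _≡_ _≡_ h)
    g-bijective⇔ =
      (⇔-id _ ×-⇔ ⇔-sym (bijective⇔injective k↔ k↔))
        ⇔-∘ (fibres-injective⇔ ⇔-∘ (g-injective⇔ ⇔-∘ bijective⇔injective K↔ K↔))
      where
      k↔ = FiniteField.enumeration Fq
      K↔ = FiniteField.enumeration Fq²

proposition2p3 : (q : ℕ) → IsPrimePower q →
  (Fq : FiniteField q) → (Fq² : FiniteField (q ^ 2)) →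
  (E : FieldEmbedding (FiniteField.field' Fq) (FiniteField.field' Fq²)) →
  let module k = FiniteField Fq
      module K = FiniteField Fq²
      ι = FieldEmbedding.ι E
  in (γ ω : K.Carrier) →
  (∀ (a b : k.Carrier) → ι a K.* γ K.+ ι b K.* ω ≡ K.0# → (a ≡ k.0#) × (b ≡ k.0#)) →
  (f : K.Carrier → k.Carrier) →
  (∀ (u : k.Carrier) (x : K.Carrier) → f (ι u K.* x) ≡ u k.* f x) →
  Bijective _≡_ _≡_ (λ (x : K.Carrier) → x K.+ γ K.* ι (f x))
    ⇔ (¬ (f γ ≡ k.- k.1#)
       × Bijective _≡_ _≡_ (λ (x : k.Carrier) → x k.+ f (ω K.+ γ K.* ι x)))
-- Only the cardinalities q and q² matter.
proposition2p3 q _ Fq Fq² E = PermutationCriterion.g-bijective⇔ Fq Fq² E
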